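{- Let $G$ and $H$ be vertex-color disjoint CCDs. The color-disjoint union $G\,\square\,H$ is ultrahomogeneous if and only if both $G$ and $H$ are ultrahomogeneous.
   Context: A complete colored digraph (CCD) $G$ consists of a finite non-empty vertex set $V(G)$, a vertex coloring $\chi_G$ and an edge coloring $\zeta_G$ on all ordered pairs of distinct vertices. Isomorphisms preserve vertex and edge colors; a partial isomorphism is an isomorphism between induced sub-CCDs; $G$ is ultrahomogeneous if every partial isomorphism extends to an automorphism. $G$ and $H$ are vertex-color disjoint if $\chi_G(V(G))\cap\chi_H(V(H))=\emptyset$. For such $G,H$ and an edge color $c$ not used in $G$ or $H$, the color-disjoint union $G\,\square\,H$ has vertex set $V(G)\sqcup V(H)$, inherited vertex colors, edge colors $\zeta_G$ on pairs inside $V(G)$, $\zeta_H$ on pairs inside $V(H)$, and $c$ on all other pairs. -}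

module Defs where

open import Data.Nat using (ℕ; _+_; _≤_)
open import Data.Fin using (Fin; splitAt; _↑ˡ_; _↑ʳ_)
open import Data.Fin.Subset using (Subset; _∈_)
open import Data.Sum using (_⊎_; inj₁; inj₂)
open import Data.Product using (Σ; Σ-syntax; ∃; ∃-syntax; proj₁; _×_)
open import Function.Bundles using (_↔_; Inverse)
open import Relation.Binary.PropositionalEquality using (_≡_; _≢_)
open import Relation.Nullary using (¬_)

-- The edge coloring ζ is
-- given on all ordered pairs, but only its values on pairs of DISTINCT vertices
-- are ever used (isomorphisms, "colors used", etc. only look at u ≢ v).
record CCD (VC EC : Set) : Set where
  field
    n        : ℕ
    nonEmpty : 1 ≤ n
    χ        : Fin n → VC
    ζ        : Fin n → Fin n → EC
open CCD public

module _ {VC EC : Set} (G : CCD VC EC) where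

  Vtx : Subset (n G) → Set
  Vtx S = Σ (Fin (n G)) (λ v → v ∈ S)

  record PartialIso : Set where
    field
      dom cod : Subset (n G)
      f       : Vtx dom ↔ Vtx cod
      pres-χ  : ∀ x → χ G (proj₁ (Inverse.to f x)) ≡ χ G (proj₁ x)
      pres-ζ  : ∀ x y → proj₁ x ≢ proj₁ y →
                ζ G (proj₁ (Inverse.to f x)) (proj₁ (Inverse.to f y))
                  ≡ ζ G (proj₁ x) (proj₁ y)

  record Automorphism : Set where
    field
      σ      : Fin (n G) ↔ Fin (n G)
      pres-χ : ∀ u → χ G (Inverse.to σ u) ≡ χ G u
      pres-ζ : ∀ u v → u ≢ v →
               ζ G (Inverse.to σ u) (Inverse.to σ v) ≡ ζ G u v

  Extends : Automorphism → PartialIso → Set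
  Extends a p = ∀ x → Inverse.to (Automorphism.σ a) (proj₁ x)
                      ≡ proj₁ (Inverse.to (PartialIso.f p) x)

  Ultrahomogeneous : Set
  Ultrahomogeneous = (p : PartialIso) → Σ[ a ∈ Automorphism ] Extends a p

  UsesEdgeColor : EC → Set
  UsesEdgeColor c = ∃[ u ] ∃[ v ] (u ≢ v × ζ G u v ≡ c)

VertexColorDisjoint : {VC EC : Set} → CCD VC EC → CCD VC EC → Set
VertexColorDisjoint G H = ∀ u v → χ G u ≢ χ H v

module _ {VC EC : Set} where

  private
    χ□ : (G H : CCD VC EC) → Fin (n G + n H) → VC
    χ□ G H x with splitAt (n G) x
    ... | inj₁ u = χ G u
    ... | inj₂ v = χ H v

    ζ□ : (G H : CCD VC EC) → EC → Fin (n G + n H) → Fin (n G + n H) → EC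
    ζ□ G H c x y with splitAt (n G) x | splitAt (n G) y
    ... | inj₁ u | inj₁ u' = ζ G u u'
    ... | inj₂ v | inj₂ v' = ζ H v v'
    ... | inj₁ _ | inj₂ _  = c
    ... | inj₂ _ | inj₁ _  = c

    ≤-plus : ∀ {a} b → 1 ≤ a → 1 ≤ a + b
    ≤-plus b (Data.Nat.s≤s _) = Data.Nat.s≤s Data.Nat.z≤n

  colorDisjointUnion : (G H : CCD VC EC) → EC → CCD VC EC
  colorDisjointUnion G H c = record
    { n        = n G + n H
    ; nonEmpty = ≤-plus (n H) (nonEmpty G)
    ; χ        = χ□ G H
    ; ζ        = ζ□ G H c
    }

{-# OPTIONS --safe #-}
-- Partial isomorphisms and automorphisms preserve vertex colors, so when the
-- vertex colors of G and H are disjoint they keep the copies of G and H inside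
-- G □ H in place, and every cross edge has color c anyway.  More generally, if
-- an induced sub-CCD A of B contains every vertex of B that carries a vertex
-- color of A, then partial isomorphisms of A lift to B and automorphisms of B
-- restrict to A, so A inherits ultrahomogeneity from B.  Conversely, a partial
-- isomorphism of G □ H restricts to partial isomorphisms of G and of H, and the
-- sum of two automorphisms extending these extends it.

module Submission where

open import Defs
open import Data.Product using (_×_)
open import Function.Bundles using (_⇔_)
open import Relation.Nullary using (¬_)

open import Data.Nat using (ℕ; _+_)
open import Data.Bool.Properties using (T-≡)
open import Data.Empty using (⊥-elim)
open import Data.Fin using (Fin; splitAt; join; _↑ˡ_; _↑ʳ_)
open import Data.Fin.Properties
  using ( _≟_; any?; splitAt-↑ˡ; splitAt-↑ʳ; splitAt⁻¹-↑ˡ; splitAt⁻¹-↑ʳ; splitAt-join; +↔⊎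
        ; ↑ˡ-injective; ↑ʳ-injective)
open import Data.Fin.Subset using (Subset; _∈_; ⊤)
open import Data.Fin.Subset.Properties using (_∈?_; ∈⊤)
open import Data.Product using (Σ; ∃-syntax; _,_; proj₁; proj₂)
open import Data.Sum using (_⊎_; inj₁; inj₂; [_,_]′)
open import Data.Sum.Function.Propositional using (_⊎-↔_)
import Data.Sum as Sum
open import Data.Vec using (tabulate; lookup)
open import Data.Vec.Properties using (lookup∘tabulate; []=⇒lookup; lookup⇒[]=)
open import Data.Vec.Properties.WithK using ([]=-irrelevant)
open import Function using (_∘_)
open import Function.Bundles using (Inverse; Injection; Equivalence; _↔_; mk↔ₛ′; mk⇔)
open import Function.Definitions using (Injective)
open import Function.Properties.Inverse using (↔-sym; ↔-trans; ↔⇒↣)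
open import Relation.Binary.PropositionalEquality
open import Relation.Nullary.Decidable using (⌊_⌋; toWitness; fromWitness; _×-dec_)

open Inverse

Vtx-≡ : ∀ {m} {S : Subset m} {x y : Σ (Fin m) (_∈ S)} → proj₁ x ≡ proj₁ y → x ≡ y
Vtx-≡ {x = u , p} {.u , q} refl = cong (u ,_) ([]=-irrelevant p q)

module _ {a b : ℕ} where

  preimage : (Fin a → Fin b) → Subset b → Subset a
  preimage f S = tabulate (λ u → lookup S (f u))

  image : (Fin a → Fin b) → Subset a → Subset b
  image f S = tabulate (λ x → ⌊ any? (λ u → u ∈? S ×-dec f u ≟ x) ⌋)

  module _ (f : Fin a → Fin b) where

    ∈-preimage⁺ : ∀ {S u} → f u ∈ S → u ∈ preimage f S
    ∈-preimage⁺ {u = u} fu∈S = lookup⇒[]= u _ (trans (lookup∘tabulate _ u) ([]=⇒lookup fu∈S))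

    ∈-preimage⁻ : ∀ {S u} → u ∈ preimage f S → f u ∈ S
    ∈-preimage⁻ {S} {u} u∈ = lookup⇒[]= (f u) S (trans (sym (lookup∘tabulate _ u)) ([]=⇒lookup u∈))

    ∈-image⁺ : ∀ {S u} → u ∈ S → f u ∈ image f S
    ∈-image⁺ {u = u} u∈S = lookup⇒[]= (f u) _
      (trans (lookup∘tabulate _ (f u)) (Equivalence.to T-≡ (fromWitness (u , u∈S , refl))))

    ∈-image⁻ : ∀ {S x} → x ∈ image f S → ∃[ u ] u ∈ S × f u ≡ x
    ∈-image⁻ {S} {x} x∈ = toWitness {a? = any? (λ u → u ∈? S ×-dec f u ≟ x)}
      (Equivalence.from T-≡ (trans (sym (lookup∘tabulate _ x)) ([]=⇒lookup x∈)))

vertex-injective : ∀ {m k} {S : Subset m} {T : Subset k}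
  (f : Σ (Fin m) (_∈ S) ↔ Σ (Fin k) (_∈ T)) {x y : Σ (Fin m) (_∈ S)} →
  proj₁ (to f x) ≡ proj₁ (to f y) → proj₁ x ≡ proj₁ y
vertex-injective f eq = cong proj₁ (Injection.injective (↔⇒↣ f) (Vtx-≡ eq))

↑ˡ-or-↑ʳ : ∀ m {k} (x : Fin (m + k)) → (∃[ u ] u ↑ˡ k ≡ x) ⊎ (∃[ v ] m ↑ʳ v ≡ x)
↑ˡ-or-↑ʳ m x with splitAt m x in eq
... | inj₁ u = inj₁ (u , splitAt⁻¹-↑ˡ eq)
... | inj₂ v = inj₂ (v , splitAt⁻¹-↑ʳ eq)

module _ {VC EC : Set} where

  record InducedIso (A : CCD VC EC) (S : Subset (n A)) (B : CCD VC EC) (T : Subset (n B)) : Set where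
    field
      bij    : Vtx A S ↔ Vtx B T
      pres-χ : ∀ x → χ B (proj₁ (to bij x)) ≡ χ A (proj₁ x)
      pres-ζ : ∀ x y → proj₁ x ≢ proj₁ y →
               ζ B (proj₁ (to bij x)) (proj₁ (to bij y)) ≡ ζ A (proj₁ x) (proj₁ y)

  module _ {A B : CCD VC EC} {S : Subset (n A)} {T : Subset (n B)} where

    InducedIso-sym : InducedIso A S B T → InducedIso B T A S
    InducedIso-sym φ = record { bij = ↔-sym bij ; pres-χ = χ-from ; pres-ζ = ζ-from }
      where
      open InducedIso φ
      χ-from : ∀ y → χ A (proj₁ (from bij y)) ≡ χ B (proj₁ y)
      χ-from y = trans (sym (pres-χ (from bij y))) (cong (χ B ∘ proj₁) (strictlyInverseˡ bij y))
      ζ-from : ∀ y y' → proj₁ y ≢ proj₁ y' →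
               ζ A (proj₁ (from bij y)) (proj₁ (from bij y')) ≡ ζ B (proj₁ y) (proj₁ y')
      ζ-from y y' y≢y' =
        trans (sym (pres-ζ _ _ (y≢y' ∘ vertex-injective (↔-sym bij))))
              (cong₂ (λ z z' → ζ B (proj₁ z) (proj₁ z')) (strictlyInverseˡ bij y) (strictlyInverseˡ bij y'))

    InducedIso-trans : ∀ {C : CCD VC EC} {R} →
                       InducedIso A S B T → InducedIso B T C R → InducedIso A S C R
    InducedIso-trans φ ψ = record
      { bij    = ↔-trans (bij φ) (bij ψ)
      ; pres-χ = λ x → trans (pres-χ ψ _) (pres-χ φ x)
      ; pres-ζ = λ x y x≢y → trans (pres-ζ ψ _ _ (x≢y ∘ vertex-injective (bij φ))) (pres-ζ φ x y x≢y)
      }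
      where open InducedIso

  module _ {G : CCD VC EC} where

    partialIso⇒inducedIso : (p : PartialIso G) →
                            InducedIso G (PartialIso.dom p) G (PartialIso.cod p)
    partialIso⇒inducedIso p = record { bij = f ; pres-χ = pres-χ ; pres-ζ = pres-ζ }
      where open PartialIso p

    inducedIso⇒partialIso : ∀ {S T} → InducedIso G S G T → PartialIso G
    inducedIso⇒partialIso φ =
      record { dom = _ ; cod = _ ; f = bij ; pres-χ = pres-χ ; pres-ζ = pres-ζ }
      where open InducedIso φ

    automorphism⇒inducedIso : Automorphism G → InducedIso G ⊤ G ⊤
    automorphism⇒inducedIso a = record
      { bij    = mk↔ₛ′ (λ (u , _) → to σ u , ∈⊤) (λ (u , _) → from σ u , ∈⊤)
                       (λ _ → Vtx-≡ (strictlyInverseˡ σ _)) (λ _ → Vtx-≡ (strictlyInverseʳ σ _))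
      ; pres-χ = λ (u , _) → pres-χ u
      ; pres-ζ = λ (u , _) (v , _) → pres-ζ u v
      }
      where open Automorphism a

    totalInducedIso⇒automorphism : ∀ {S T} → (∀ u → u ∈ S) → (∀ u → u ∈ T) →
                                   InducedIso G S G T → Automorphism G
    totalInducedIso⇒automorphism inS inT φ = record
      { σ      = mk↔ₛ′ (λ u → proj₁ (to bij (u , inS u))) (λ u → proj₁ (from bij (u , inT u)))
                       (λ u → cong proj₁ (trans (cong (to bij) (Vtx-≡ refl)) (strictlyInverseˡ bij _)))
                       (λ u → cong proj₁ (trans (cong (from bij) (Vtx-≡ refl)) (strictlyInverseʳ bij _)))
      ; pres-χ = λ u → pres-χ (u , inS u)
      ; pres-ζ = λ u v → pres-ζ (u , inS u) (v , inS v)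
      }
      where open InducedIso φ

  record Embedding (A B : CCD VC EC) : Set where
    field
      embed     : Fin (n A) → Fin (n B)
      injective : Injective _≡_ _≡_ embed
      pres-χ    : ∀ u → χ B (embed u) ≡ χ A u
      pres-ζ    : ∀ u v → u ≢ v → ζ B (embed u) (embed v) ≡ ζ A u v

  ColorClosed : ∀ {A B} → Embedding A B → Set
  ColorClosed {A} {B} ι = ∀ x u → χ B x ≡ χ A u → ∃[ w ] Embedding.embed ι w ≡ x

  module _ {A B : CCD VC EC} (ι : Embedding A B) where
    open Embedding ι

    imageIso : ∀ S → InducedIso A S B (image embed S)
    imageIso S = record
      { bij    = mk↔ₛ′ (λ (u , u∈S) → embed u , ∈-image⁺ embed u∈S)
                       (λ (_ , x∈) → proj₁ (∈-image⁻ embed x∈) , proj₁ (proj₂ (∈-image⁻ embed x∈)))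
                       (λ (_ , x∈) → Vtx-≡ (proj₂ (proj₂ (∈-image⁻ embed x∈))))
                       (λ (_ , u∈S) →
                          Vtx-≡ (injective (proj₂ (proj₂ (∈-image⁻ embed (∈-image⁺ embed u∈S))))))
      ; pres-χ = λ (u , _) → pres-χ u
      ; pres-ζ = λ (u , _) (v , _) → pres-ζ u v
      }

    liftPartialIso : PartialIso A → PartialIso B
    liftPartialIso p = inducedIso⇒partialIso
      (InducedIso-trans (InducedIso-sym (imageIso (PartialIso.dom p)))
                        (InducedIso-trans (partialIso⇒inducedIso p) (imageIso (PartialIso.cod p))))

    liftPartialIso-to : ∀ p (x : Vtx A (PartialIso.dom p)) →
      proj₁ (to (PartialIso.f (liftPartialIso p)) (embed (proj₁ x) , ∈-image⁺ embed (proj₂ x)))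
        ≡ embed (proj₁ (to (PartialIso.f p) x))
    liftPartialIso-to p x =
      cong (embed ∘ proj₁ ∘ to (PartialIso.f p)) (strictlyInverseʳ (InducedIso.bij (imageIso _)) x)

    VertexColorPreserving : ∀ {S T} → (Vtx B S → Vtx B T) → Set
    VertexColorPreserving g = ∀ x → χ B (proj₁ (g x)) ≡ χ B (proj₁ x)

    module _ (closed : ColorClosed ι) {S T : Subset (n B)}
             (g : Vtx B S → Vtx B T) (g-χ : VertexColorPreserving g) where

      private
        g∘embed : Vtx A (preimage embed S) → Vtx B T
        g∘embed (u , u∈) = g (embed u , ∈-preimage⁻ embed u∈)

        factor : ∀ x → ∃[ w ] embed w ≡ proj₁ (g∘embed x)
        factor x@(u , _) = closed _ u (trans (g-χ _) (pres-χ u))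

      pullback : Vtx A (preimage embed S) → Vtx A (preimage embed T)
      pullback x = proj₁ (factor x)
                 , ∈-preimage⁺ embed (subst (_∈ T) (sym (proj₂ (factor x))) (proj₂ (g∘embed x)))

      embed-pullback : ∀ x →
        embed (proj₁ (pullback x)) ≡ proj₁ (g (embed (proj₁ x) , ∈-preimage⁻ embed (proj₂ x)))
      embed-pullback x = proj₂ (factor x)

    module _ (closed : ColorClosed ι) where

      pullback-inverse : ∀ {S T} (g : Vtx B S → Vtx B T) (h : Vtx B T → Vtx B S)
        (g-χ : VertexColorPreserving g) (h-χ : VertexColorPreserving h) →
        (∀ y → g (h y) ≡ y) → ∀ y → pullback closed g g-χ (pullback closed h h-χ y) ≡ y
      pullback-inverse g h g-χ h-χ g∘h y = Vtx-≡ (injective (begin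
        embed (proj₁ (pullback closed g g-χ (pullback closed h h-χ y)))
          ≡⟨ embed-pullback closed g g-χ (pullback closed h h-χ y) ⟩
        proj₁ (g (embed (proj₁ (pullback closed h h-χ y)) , _))
          ≡⟨ cong (proj₁ ∘ g) (Vtx-≡ (embed-pullback closed h h-χ y)) ⟩
        proj₁ (g (h (embed (proj₁ y) , ∈-preimage⁻ embed (proj₂ y))))
          ≡⟨ cong proj₁ (g∘h _) ⟩
        embed (proj₁ y) ∎))
        where open ≡-Reasoning

      restrictInducedIso : ∀ {S T} → InducedIso B S B T →
                           InducedIso A (preimage embed S) A (preimage embed T)
      restrictInducedIso {S} {T} φ = record
        { bij    = mk↔ₛ′ to′ from′ (pullback-inverse (to bij) (from bij) φ-χ from-χ (strictlyInverseˡ bij))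
                                   (pullback-inverse (from bij) (to bij) from-χ φ-χ (strictlyInverseʳ bij))
        ; pres-χ = χ-to′
        ; pres-ζ = ζ-to′
        }
        where
        open InducedIso φ renaming (pres-χ to φ-χ; pres-ζ to φ-ζ)
        from-χ : VertexColorPreserving (from bij)
        from-χ = InducedIso.pres-χ (InducedIso-sym φ)
        to′ : Vtx A (preimage embed S) → Vtx A (preimage embed T)
        to′ = pullback closed (to bij) φ-χ
        from′ : Vtx A (preimage embed T) → Vtx A (preimage embed S)
        from′ = pullback closed (from bij) from-χ
        embed-to′ : ∀ x →
          embed (proj₁ (to′ x)) ≡ proj₁ (to bij (embed (proj₁ x) , ∈-preimage⁻ embed (proj₂ x)))
        embed-to′ = embed-pullback closed (to bij) φ-χ
        open ≡-Reasoning

        χ-to′ : ∀ x → χ A (proj₁ (to′ x)) ≡ χ A (proj₁ x)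
        χ-to′ x@(u , _) = begin
          χ A (proj₁ (to′ x))         ≡⟨ sym (pres-χ _) ⟩
          χ B (embed (proj₁ (to′ x))) ≡⟨ cong (χ B) (embed-to′ x) ⟩
          χ B (proj₁ (to bij _))      ≡⟨ φ-χ _ ⟩
          χ B (embed u)               ≡⟨ pres-χ u ⟩
          χ A u                       ∎

        ζ-to′ : ∀ x y → proj₁ x ≢ proj₁ y →
                ζ A (proj₁ (to′ x)) (proj₁ (to′ y)) ≡ ζ A (proj₁ x) (proj₁ y)
        ζ-to′ x@(u , _) y@(v , _) u≢v = begin
          ζ A (proj₁ (to′ x)) (proj₁ (to′ y))
            ≡⟨ sym (pres-ζ _ _ to′x≢to′y) ⟩
          ζ B (embed (proj₁ (to′ x))) (embed (proj₁ (to′ y)))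
            ≡⟨ cong₂ (ζ B) (embed-to′ x) (embed-to′ y) ⟩
          ζ B (proj₁ (to bij _)) (proj₁ (to bij _))
            ≡⟨ φ-ζ _ _ (u≢v ∘ injective) ⟩
          ζ B (embed u) (embed v)
            ≡⟨ pres-ζ u v u≢v ⟩
          ζ A u v ∎
          where
          to′x≢to′y : proj₁ (to′ x) ≢ proj₁ (to′ y)
          to′x≢to′y eq = u≢v (injective (vertex-injective bij
            (trans (sym (embed-to′ x)) (trans (cong embed eq) (embed-to′ y)))))

      restrictPartialIso : PartialIso B → PartialIso A
      restrictPartialIso q = inducedIso⇒partialIso (restrictInducedIso (partialIso⇒inducedIso q))

      restrictAutomorphism : Automorphism B → Automorphism A
      restrictAutomorphism a =
        totalInducedIso⇒automorphism (λ _ → ∈-preimage⁺ embed ∈⊤) (λ _ → ∈-preimage⁺ embed ∈⊤)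
                                     (restrictInducedIso (automorphism⇒inducedIso a))

      embed-restrictAutomorphism : ∀ a u →
        embed (to (Automorphism.σ (restrictAutomorphism a)) u) ≡ to (Automorphism.σ a) (embed u)
      embed-restrictAutomorphism a u = embed-pullback closed (to bij) a-χ (u , ∈-preimage⁺ embed ∈⊤)
        where open InducedIso (automorphism⇒inducedIso a) renaming (pres-χ to a-χ)

      restrictAutomorphism-extends : ∀ a p → Extends B a (liftPartialIso p) →
                                     Extends A (restrictAutomorphism a) p
      restrictAutomorphism-extends a p a-extends x@(u , u∈) = injective (begin
        embed (to (Automorphism.σ (restrictAutomorphism a)) u)
          ≡⟨ embed-restrictAutomorphism a u ⟩
        to (Automorphism.σ a) (embed u)
          ≡⟨ a-extends (embed u , ∈-image⁺ embed u∈) ⟩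
        proj₁ (to (PartialIso.f (liftPartialIso p)) (embed u , ∈-image⁺ embed u∈))
          ≡⟨ liftPartialIso-to p x ⟩
        embed (proj₁ (to (PartialIso.f p) x)) ∎)
        where open ≡-Reasoning

      extends-on-image : ∀ (a : Automorphism B) (aA : Automorphism A) q →
        (∀ u → to (Automorphism.σ a) (embed u) ≡ embed (to (Automorphism.σ aA) u)) →
        Extends A aA (restrictPartialIso q) →
        ∀ u (u∈ : embed u ∈ PartialIso.dom q) →
        to (Automorphism.σ a) (embed u) ≡ proj₁ (to (PartialIso.f q) (embed u , u∈))
      extends-on-image a aA q a∘embed aA-extends u u∈ = begin
        to (Automorphism.σ a) (embed u)
          ≡⟨ a∘embed u ⟩
        embed (to (Automorphism.σ aA) u)
          ≡⟨ cong embed (aA-extends (u , ∈-preimage⁺ embed u∈)) ⟩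
        embed (proj₁ (to (PartialIso.f (restrictPartialIso q)) (u , ∈-preimage⁺ embed u∈)))
          ≡⟨ embed-pullback closed (to f) q-χ (u , ∈-preimage⁺ embed u∈) ⟩
        proj₁ (to f (embed u , ∈-preimage⁻ embed (∈-preimage⁺ embed u∈)))
          ≡⟨ cong (proj₁ ∘ to f) (Vtx-≡ refl) ⟩
        proj₁ (to f (embed u , u∈)) ∎
        where
        open PartialIso q using (f) renaming (pres-χ to q-χ)
        open ≡-Reasoning

      closedEmbedding-ultrahomogeneous : Ultrahomogeneous B → Ultrahomogeneous A
      closedEmbedding-ultrahomogeneous B-uh p =
        let a , a-extends = B-uh (liftPartialIso p)
        in restrictAutomorphism a , restrictAutomorphism-extends a p a-extends

module _ {VC EC : Set} (G H : CCD VC EC) (c : EC) where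

  G□H : CCD VC EC
  G□H = colorDisjointUnion G H c

  χ-□ : ∀ x → χ G□H x ≡ [ χ G , χ H ]′ (splitAt (n G) x)
  χ-□ x with splitAt (n G) x
  ... | inj₁ _ = refl
  ... | inj₂ _ = refl

  ζ-⊎ : Fin (n G) ⊎ Fin (n H) → Fin (n G) ⊎ Fin (n H) → EC
  ζ-⊎ (inj₁ u) (inj₁ u') = ζ G u u'
  ζ-⊎ (inj₂ v) (inj₂ v') = ζ H v v'
  ζ-⊎ (inj₁ _) (inj₂ _)  = c
  ζ-⊎ (inj₂ _) (inj₁ _)  = c

  ζ-□ : ∀ x y → ζ G□H x y ≡ ζ-⊎ (splitAt (n G) x) (splitAt (n G) y)
  ζ-□ x y with splitAt (n G) x | splitAt (n G) y
  ... | inj₁ _ | inj₁ _ = refl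
  ... | inj₂ _ | inj₂ _ = refl
  ... | inj₁ _ | inj₂ _ = refl
  ... | inj₂ _ | inj₁ _ = refl

  inl-□ : Embedding G G□H
  inl-□ = record
    { embed     = _↑ˡ n H
    ; injective = ↑ˡ-injective (n H) _ _
    ; pres-χ    = λ u → trans (χ-□ _) (cong [ χ G , χ H ]′ (splitAt-↑ˡ (n G) u (n H)))
    ; pres-ζ    = λ u u' _ → trans (ζ-□ _ _)
                    (cong₂ ζ-⊎ (splitAt-↑ˡ (n G) u (n H)) (splitAt-↑ˡ (n G) u' (n H)))
    }

  inr-□ : Embedding H G□H
  inr-□ = record
    { embed     = n G ↑ʳ_
    ; injective = ↑ʳ-injective (n G) _ _
    ; pres-χ    = λ v → trans (χ-□ _) (cong [ χ G , χ H ]′ (splitAt-↑ʳ (n G) (n H) v))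
    ; pres-ζ    = λ v v' _ → trans (ζ-□ _ _)
                    (cong₂ ζ-⊎ (splitAt-↑ʳ (n G) (n H) v) (splitAt-↑ʳ (n G) (n H) v'))
    }

  _⊕_ : Automorphism G → Automorphism H → Automorphism G□H
  aG ⊕ aH = record
    { σ      = ↔-trans +↔⊎ (↔-trans (σG ⊎-↔ σH) (↔-sym +↔⊎))
    ; pres-χ = χ-σ
    ; pres-ζ = ζ-σ
    }
    where
    open ≡-Reasoning
    σG = Automorphism.σ aG
    σH = Automorphism.σ aH

    σ⊎ : Fin (n G) ⊎ Fin (n H) → Fin (n G) ⊎ Fin (n H)
    σ⊎ = Sum.map (to σG) (to σH)

    χ-σ⊎ : ∀ s → [ χ G , χ H ]′ (σ⊎ s) ≡ [ χ G , χ H ]′ s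
    χ-σ⊎ (inj₁ u) = Automorphism.pres-χ aG u
    χ-σ⊎ (inj₂ v) = Automorphism.pres-χ aH v

    ζ-σ⊎ : ∀ s t → s ≢ t → ζ-⊎ (σ⊎ s) (σ⊎ t) ≡ ζ-⊎ s t
    ζ-σ⊎ (inj₁ u) (inj₁ u') s≢t = Automorphism.pres-ζ aG u u' (s≢t ∘ cong inj₁)
    ζ-σ⊎ (inj₂ v) (inj₂ v') s≢t = Automorphism.pres-ζ aH v v' (s≢t ∘ cong inj₂)
    ζ-σ⊎ (inj₁ _) (inj₂ _)  _   = refl
    ζ-σ⊎ (inj₂ _) (inj₁ _)  _   = refl

    χ-σ : ∀ x → χ G□H (join (n G) (n H) (σ⊎ (splitAt (n G) x))) ≡ χ G□H x
    χ-σ x = begin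
      χ G□H (join (n G) (n H) s′)
        ≡⟨ χ-□ _ ⟩
      [ χ G , χ H ]′ (splitAt (n G) (join (n G) (n H) s′))
        ≡⟨ cong [ χ G , χ H ]′ (splitAt-join (n G) (n H) s′) ⟩
      [ χ G , χ H ]′ (σ⊎ (splitAt (n G) x))
        ≡⟨ χ-σ⊎ (splitAt (n G) x) ⟩
      [ χ G , χ H ]′ (splitAt (n G) x)
        ≡⟨ χ-□ x ⟨
      χ G□H x ∎
      where s′ = σ⊎ (splitAt (n G) x)

    ζ-σ : ∀ x y → x ≢ y →
          ζ G□H (join (n G) (n H) (σ⊎ (splitAt (n G) x))) (join (n G) (n H) (σ⊎ (splitAt (n G) y)))
            ≡ ζ G□H x y
    ζ-σ x y x≢y = begin
      ζ G□H (join (n G) (n H) s′) (join (n G) (n H) t′)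
        ≡⟨ ζ-□ _ _ ⟩
      ζ-⊎ (splitAt (n G) (join (n G) (n H) s′)) (splitAt (n G) (join (n G) (n H) t′))
        ≡⟨ cong₂ ζ-⊎ (splitAt-join (n G) (n H) s′) (splitAt-join (n G) (n H) t′) ⟩
      ζ-⊎ s′ t′
        ≡⟨ ζ-σ⊎ (splitAt (n G) x) (splitAt (n G) y) (x≢y ∘ Injection.injective (↔⇒↣ +↔⊎)) ⟩
      ζ-⊎ (splitAt (n G) x) (splitAt (n G) y)
        ≡⟨ ζ-□ x y ⟨
      ζ G□H x y ∎
      where
      s′ = σ⊎ (splitAt (n G) x)
      t′ = σ⊎ (splitAt (n G) y)

  module _ (aG : Automorphism G) (aH : Automorphism H) where

    ⊕-↑ˡ : ∀ u → to (Automorphism.σ (aG ⊕ aH)) (u ↑ˡ n H) ≡ to (Automorphism.σ aG) u ↑ˡ n H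
    ⊕-↑ˡ u = cong (join (n G) (n H) ∘ Sum.map (to (Automorphism.σ aG)) (to (Automorphism.σ aH)))
                  (splitAt-↑ˡ (n G) u (n H))

    ⊕-↑ʳ : ∀ v → to (Automorphism.σ (aG ⊕ aH)) (n G ↑ʳ v) ≡ n G ↑ʳ to (Automorphism.σ aH) v
    ⊕-↑ʳ v = cong (join (n G) (n H) ∘ Sum.map (to (Automorphism.σ aG)) (to (Automorphism.σ aH)))
                  (splitAt-↑ʳ (n G) (n H) v)

  module _ (disjoint : VertexColorDisjoint G H) where

    inl-□-colorClosed : ColorClosed inl-□
    inl-□-colorClosed x u χx≡χu with ↑ˡ-or-↑ʳ (n G) x
    ... | inj₁ x∈G       = x∈G
    ... | inj₂ (v , refl) = ⊥-elim (disjoint u v (trans (sym χx≡χu) (Embedding.pres-χ inr-□ v)))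

    inr-□-colorClosed : ColorClosed inr-□
    inr-□-colorClosed x v χx≡χv with ↑ˡ-or-↑ʳ (n G) x
    ... | inj₂ x∈H       = x∈H
    ... | inj₁ (u , refl) = ⊥-elim (disjoint u v (trans (sym (Embedding.pres-χ inl-□ u)) χx≡χv))

    ⊕-extends : ∀ aG aH q → Extends G aG (restrictPartialIso inl-□ inl-□-colorClosed q) →
                Extends H aH (restrictPartialIso inr-□ inr-□-colorClosed q) → Extends G□H (aG ⊕ aH) q
    ⊕-extends aG aH q aG-extends aH-extends (x , x∈) with ↑ˡ-or-↑ʳ (n G) x
    ... | inj₁ (u , refl) =
      extends-on-image inl-□ inl-□-colorClosed (aG ⊕ aH) aG q (⊕-↑ˡ aG aH) aG-extends u x∈
    ... | inj₂ (v , refl) =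
      extends-on-image inr-□ inr-□-colorClosed (aG ⊕ aH) aH q (⊕-↑ʳ aG aH) aH-extends v x∈

    □-ultrahomogeneous : Ultrahomogeneous G → Ultrahomogeneous H → Ultrahomogeneous G□H
    □-ultrahomogeneous G-uh H-uh q =
      let aG , aG-extends = G-uh (restrictPartialIso inl-□ inl-□-colorClosed q)
          aH , aH-extends = H-uh (restrictPartialIso inr-□ inr-□-colorClosed q)
      in aG ⊕ aH , ⊕-extends aG aH q aG-extends aH-extends

mainTheorem5 : {VC EC : Set} (G H : CCD VC EC) (c : EC) →
    VertexColorDisjoint G H →
    ¬ UsesEdgeColor G c → ¬ UsesEdgeColor H c →
    Ultrahomogeneous (colorDisjointUnion G H c) ⇔ (Ultrahomogeneous G × Ultrahomogeneous H)
mainTheorem5 G H c disjoint _ _ = mk⇔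
  (λ □-uh → closedEmbedding-ultrahomogeneous (inl-□ G H c) (inl-□-colorClosed G H c disjoint) □-uh
          , closedEmbedding-ultrahomogeneous (inr-□ G H c) (inr-□-colorClosed G H c disjoint) □-uh)
  (λ (G-uh , H-uh) → □-ultrahomogeneous G H c disjoint G-uh H-uh)
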